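{- Let $\mathbb{F}_q$ be a finite field, $\mathcal{V}$ a vector space over $\mathbb{F}_q$, and $k,t$ integers with $0\le t\le k$. Let $n\ge 3$ and let $\mathcal{C}=\{\pi_1,\ldots,\pi_n\}$ be a $(k,k-t)$-SCID in $\mathcal{V}$. Define $S:=\langle \pi_1,\ldots,\pi_n\rangle$ and $I:=\langle \pi_i\cap\pi_j \mid 1\le i<j\le n\rangle$. Then \[\dim S+\dim I\le (n-1)k+2t.\]
   Context: A $(k,k-t)$-SCID is a set of (distinct) $k$-dimensional subspaces of $\mathcal{V}$, containing at least two elements, such that any two distinct members intersect in a subspace of dimension exactly $k-t$. $\langle\cdot\rangle$ denotes the span. -}

module Defs where

open import Level using (Level; _⊔_) renaming (suc to lsuc)
open import Algebra.Bundles using (CommutativeRing)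
open import Algebra.Module.Bundles using (Module)
open import Data.Nat using (ℕ; _≤_; _∸_) renaming (zero to nzero; suc to nsuc)
open import Data.Fin using (Fin; zero; suc)
open import Data.Product using (Σ; ∃; _×_; _,_)
open import Relation.Binary.PropositionalEquality using (_≡_; _≢_)
import Data.Fin as Fin
open import Relation.Nullary using (¬_)

private
  variable
    r ℓr m ℓm : Level

record IsFiniteField (F : CommutativeRing r ℓr) : Set (r ⊔ ℓr) where
  open CommutativeRing F
  field
    1≉0     : ¬ (1# ≈ 0#)
    inverse : ∀ x → ¬ (x ≈ 0#) → ∃ λ y → (x * y) ≈ 1#
    q       : ℕ
    enum    : Fin q → Carrier
    index   : Carrier → Fin q
    enum-index  : ∀ x → enum (index x) ≈ x
    index-enum  : ∀ i → index (enum i) ≡ i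
    index-cong  : ∀ {x y} → x ≈ y → index x ≡ index y

module VectorSpace {F : CommutativeRing r ℓr} (V : Module F m ℓm) where
  open CommutativeRing F using () renaming (Carrier to K; _≈_ to _≈K_; 0# to 0K)
  open Module V

  sumV : ∀ {d} → (Fin d → Carrierᴹ) → Carrierᴹ
  sumV {nzero}  f = 0ᴹ
  sumV {nsuc d} f = f zero +ᴹ sumV (λ i → f (suc i))

  lincomb : ∀ {d} → (Fin d → K) → (Fin d → Carrierᴹ) → Carrierᴹ
  lincomb c v = sumV (λ i → c i *ₗ v i)

  record Subspace (p : Level) : Set (r ⊔ m ⊔ ℓm ⊔ lsuc p) where
    field
      _∈_     : Carrierᴹ → Set p
      ∈-resp  : ∀ {x y} → x ≈ᴹ y → _∈_ x → _∈_ y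
      0∈      : _∈_ 0ᴹ
      +-closed : ∀ {x y} → _∈_ x → _∈_ y → _∈_ (x +ᴹ y)
      *-closed : ∀ c {x} → _∈_ x → _∈_ (c *ₗ x)
  open Subspace public

  _≐_ : ∀ {p} → Subspace p → Subspace p → Set (m ⊔ p)
  U ≐ W = ∀ x → ((_∈_ U x → _∈_ W x) × (_∈_ W x → _∈_ U x))

  record HasDim {p} (U : Carrierᴹ → Set p) (d : ℕ) : Set (r ⊔ ℓr ⊔ m ⊔ ℓm ⊔ p) where
    field
      basis        : Fin d → Carrierᴹ
      basis-in     : ∀ i → U (basis i)
      independent  : ∀ (c : Fin d → K) → lincomb c basis ≈ᴹ 0ᴹ → ∀ i → c i ≈K 0K
      spanning     : ∀ x → U x → ∃ λ (c : Fin d → K) → x ≈ᴹ lincomb c basis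

  _∩_ : ∀ {p} → Subspace p → Subspace p → Subspace p
  U ∩ W = record
    { _∈_ = λ x → _∈_ U x × _∈_ W x
    ; ∈-resp = λ { e (a , b) → ∈-resp U e a , ∈-resp W e b }
    ; 0∈ = 0∈ U , 0∈ W
    ; +-closed = λ { (a , b) (a' , b') → +-closed U a a' , +-closed W b b' }
    ; *-closed = λ { c (a , b) → *-closed U c a , *-closed W c b }
    }

  ⟨_⟩ : ∀ {a} → (Carrierᴹ → Set a) → Carrierᴹ → Set (r ⊔ m ⊔ ℓm ⊔ a)
  ⟨ A ⟩ x = ∃ λ d → Σ (Fin d → K) λ c → Σ (Fin d → Carrierᴹ) λ v →
              ((∀ i → A (v i)) × (x ≈ᴹ lincomb c v))

  spanAll : ∀ {n p} → (Fin n → Subspace p) → Carrierᴹ → Set (r ⊔ m ⊔ ℓm ⊔ p)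
  spanAll π = ⟨ (λ v → ∃ λ i → _∈_ (π i) v) ⟩

  spanInter : ∀ {n p} → (Fin n → Subspace p) → Carrierᴹ → Set (r ⊔ m ⊔ ℓm ⊔ p)
  spanInter π = ⟨ (λ v → ∃ λ i → ∃ λ j → (i Fin.< j) × _∈_ (π i ∩ π j) v) ⟩

  record IsSCID {n p} (k t : ℕ) (π : Fin n → Subspace p) : Set (r ⊔ ℓr ⊔ m ⊔ ℓm ⊔ p) where
    field
      atLeastTwo : 2 ≤ n
      distinct   : ∀ i j → i ≢ j → ¬ (π i ≐ π j)
      dim-k      : ∀ i → HasDim (_∈_ (π i)) k
      dim-meet   : ∀ i j → i ≢ j → HasDim (_∈_ (π i ∩ π j)) (k ∸ t)

-- By induction on n, build finite families S and I, S spanning every πᵢ and I every πᵢ ∩ πⱼ,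
-- with |S| + |I| ≤ (n−1)k + 2t; a basis of the space ⟨π₁,…,πₙ⟩ (resp. ⟨πᵢ ∩ πⱼ⟩) is an
-- independent family in the span of S (resp. I), so Steinitz exchange bounds its size by |S| (resp. |I|).
-- To add a space π₀ to a covered family, take a basis g of Σⱼ π₀ ∩ πⱼ (it lies in the span of
-- the old S) and complete it by h to a basis of π₀: then h ++ S and g ++ I cover the larger
-- family and |h| + |g| ≤ k. For three spaces, π₁ + π₂ is spanned by k + t vectors, and since
-- π₀ ∩ π₁ ⊆ ⟨g⟩, extending a basis of π₀ ∩ π₁ inside π₁ to span π₁ ∩ π₂ costs only t vectors
-- beyond g; this gives 2k + 2t.
-- Finiteness of the field makes membership in the span of a finite family decidable (by
-- searching all coefficient vectors), which is what the constructive exchange arguments need.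
module Submission where

open import Level using (Level; _⊔_)
open import Algebra.Bundles using (CommutativeRing)
open import Algebra.Module.Bundles using (Module)
open import Data.Nat as ℕ using (ℕ; zero; suc; z≤n; s≤s)
import Data.Nat.Properties as ℕ
open import Data.Fin using (Fin; zero; suc; punchIn; combine; splitAt; _<_)
open import Data.Fin.Patterns using (0F; 1F; 2F)
open import Data.Fin.Properties using (any?; all?; remQuot-combine; suc-injective; <⇒≢)
  renaming (_≟_ to _≟ᶠ_)
open import Data.Product using (Σ; ∃; _×_; _,_; proj₁; proj₂; uncurry; swap)
open import Data.Empty using (⊥-elim)
open import Data.Sum using (inj₁; inj₂)
open import Data.Vec.Functional using (Vector; []; _∷_; _++_; concat; insertAt)
open import Data.Vec.Functional.Properties using (insertAt-lookup; insertAt-punchIn)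
open import Data.Vec.Functional.Relation.Unary.All using (All)
open import Data.Vec.Functional.Relation.Unary.All.Properties using (++⁺; ++⁻ˡ; ++⁻ʳ)
open import Function using (_∘_; flip)
open import Relation.Nullary using (¬_; Dec; yes; no; ¬?)
open import Relation.Nullary.Decidable using (decidable-stable; map′)
open import Relation.Binary.PropositionalEquality as ≡ using (_≡_; _≢_; refl)

open import Defs

module _ {r ℓr : Level} (F : CommutativeRing r ℓr) where

  open CommutativeRing F
  open import Relation.Binary.Reasoning.Setoid setoid
  open import Algebra.Properties.Ring ring using (-‿distribˡ-*)

  pivot-cancel : ∀ {a b z} → b * z ≈ 1# → a + - (a * z) * b ≈ 0#
  pivot-cancel {a} {b} {z} bz≈1 = begin
    a + - (a * z) * b     ≈⟨ +-congˡ (-‿distribˡ-* (a * z) b) ⟨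
    a + - ((a * z) * b)   ≈⟨ +-congˡ (-‿cong (*-assoc a z b)) ⟩
    a + - (a * (z * b))   ≈⟨ +-congˡ (-‿cong (*-congˡ (trans (*-comm z b) bz≈1))) ⟩
    a + - (a * 1#)        ≈⟨ +-congˡ (-‿cong (*-identityʳ a)) ⟩
    a + - a               ≈⟨ -‿inverseʳ a ⟩
    0#                    ∎

module LinearAlgebra {r ℓr m ℓm : Level} {F : CommutativeRing r ℓr} (FF : IsFiniteField F)
                     (V : Module F m ℓm) where

  open CommutativeRing F hiding (zero)
    renaming (Carrier to K; refl to ≈-refl; sym to ≈-sym; trans to ≈-trans; reflexive to ≈-reflexive)
  open Module V
  open VectorSpace V
  open IsFiniteField FF using (1≉0; inverse; enum; index; enum-index; index-cong)
  open import Relation.Binary.Reasoning.Setoid ≈ᴹ-setoid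
  open import Algebra.Properties.CommutativeMonoid.Sum +ᴹ-commutativeMonoid
    using (sum; ∑-distrib-+; sum-remove)
  open import Algebra.Properties.CommutativeMonoid.Sum +-commutativeMonoid
    using () renaming (sum to ∑)
  open import Algebra.Properties.Group +ᴹ-group using (inverseˡ-unique)
  open import Algebra.Properties.Group +-group using (x∙y⁻¹≈ε⇒x≈y)

  Family : ℕ → Set m
  Family = Vector Carrierᴹ

  sumV≡sum : ∀ {d} (f : Family d) → sumV f ≡ sum f
  sumV≡sum {zero}  f = refl
  sumV≡sum {suc d} f = ≡.cong (f zero +ᴹ_) (sumV≡sum (f ∘ suc))

  sumV-cong : ∀ {d} {f g : Family d} → (∀ i → f i ≈ᴹ g i) → sumV f ≈ᴹ sumV g
  sumV-cong {zero}  e = ≈ᴹ-refl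
  sumV-cong {suc d} e = +ᴹ-cong (e zero) (sumV-cong (e ∘ suc))

  sumV-distrib-+ : ∀ {d} (f g : Family d) → sumV (λ i → f i +ᴹ g i) ≈ᴹ sumV f +ᴹ sumV g
  sumV-distrib-+ f g = begin
    sumV (λ i → f i +ᴹ g i) ≡⟨ sumV≡sum (λ i → f i +ᴹ g i) ⟩
    sum (λ i → f i +ᴹ g i)  ≈⟨ ∑-distrib-+ f g ⟩
    sum f +ᴹ sum g          ≡⟨ ≡.sym (≡.cong₂ _+ᴹ_ (sumV≡sum f) (sumV≡sum g)) ⟩
    sumV f +ᴹ sumV g        ∎

  sumV-remove : ∀ {d} (f : Family (suc d)) i → sumV f ≈ᴹ f i +ᴹ sumV (f ∘ punchIn i)
  sumV-remove f i = begin
    sumV f                          ≡⟨ sumV≡sum f ⟩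
    sum f                           ≈⟨ sum-remove f ⟩
    f i +ᴹ sum (f ∘ punchIn i)      ≡⟨ ≡.cong (f i +ᴹ_) (≡.sym (sumV≡sum (f ∘ punchIn i))) ⟩
    f i +ᴹ sumV (f ∘ punchIn i)     ∎

  sumV-*ₗ : ∀ {d} a (f : Family d) → sumV (λ i → a *ₗ f i) ≈ᴹ a *ₗ sumV f
  sumV-*ₗ {zero}  a f = ≈ᴹ-sym (*ₗ-zeroʳ a)
  sumV-*ₗ {suc d} a f = ≈ᴹ-trans (+ᴹ-congˡ (sumV-*ₗ a (f ∘ suc))) (≈ᴹ-sym (*ₗ-distribˡ a _ _))

  sumV-scalars : ∀ {d} (c : Fin d → K) x → sumV (λ i → c i *ₗ x) ≈ᴹ ∑ c *ₗ x
  sumV-scalars {zero}  c x = ≈ᴹ-sym (*ₗ-zeroˡ x)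
  sumV-scalars {suc d} c x = ≈ᴹ-trans (+ᴹ-congˡ (sumV-scalars (c ∘ suc) x)) (≈ᴹ-sym (*ₗ-distribʳ x _ _))

  lincomb-cong : ∀ {d} {c c' : Fin d → K} {w w' : Family d} →
                 (∀ i → c i ≈ c' i) → (∀ i → w i ≈ᴹ w' i) → lincomb c w ≈ᴹ lincomb c' w'
  lincomb-cong ec ew = sumV-cong (λ i → *ₗ-cong (ec i) (ew i))

  lincomb-+ : ∀ {d} (c e : Fin d → K) (w : Family d) →
              lincomb (λ i → c i + e i) w ≈ᴹ lincomb c w +ᴹ lincomb e w
  lincomb-+ c e w = ≈ᴹ-trans (sumV-cong (λ i → *ₗ-distribʳ (w i) (c i) (e i)))
                             (sumV-distrib-+ (λ i → c i *ₗ w i) (λ i → e i *ₗ w i))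

  lincomb-* : ∀ {d} a (c : Fin d → K) (w : Family d) → lincomb (λ i → a * c i) w ≈ᴹ a *ₗ lincomb c w
  lincomb-* a c w = ≈ᴹ-trans (sumV-cong (λ i → *ₗ-assoc a (c i) (w i))) (sumV-*ₗ a (λ i → c i *ₗ w i))

  lincomb-0 : ∀ {d} (w : Family d) → lincomb (λ _ → 0#) w ≈ᴹ 0ᴹ
  lincomb-0 {zero}  w = ≈ᴹ-refl
  lincomb-0 {suc d} w = ≈ᴹ-trans (+ᴹ-cong (*ₗ-zeroˡ (w zero)) (lincomb-0 (w ∘ suc))) (+ᴹ-identityˡ 0ᴹ)

  lincomb-neg : ∀ {d} (c : Fin d → K) (w : Family d) → lincomb (λ i → - c i) w ≈ᴹ -ᴹ lincomb c w
  lincomb-neg c w = inverseˡ-unique _ _ (begin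
    lincomb (λ i → - c i) w +ᴹ lincomb c w ≈⟨ lincomb-+ (λ i → - c i) c w ⟨
    lincomb (λ i → - c i + c i) w          ≈⟨ lincomb-cong (λ i → -‿inverseˡ (c i)) (λ _ → ≈ᴹ-refl) ⟩
    lincomb (λ _ → 0#) w                    ≈⟨ lincomb-0 w ⟩
    0ᴹ                                      ∎)

  lincomb-sub : ∀ {d} (c e : Fin d → K) (w : Family d) →
              lincomb (λ i → c i - e i) w ≈ᴹ lincomb c w +ᴹ -ᴹ lincomb e w
  lincomb-sub c e w = ≈ᴹ-trans (lincomb-+ c (λ i → - e i) w) (+ᴹ-congˡ (lincomb-neg e w))

  unit : ∀ {d} → Fin d → Fin d → K
  unit zero    = 1# ∷ λ _ → 0#
  unit (suc i) = 0# ∷ unit i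

  lincomb-unit : ∀ {d} (w : Family d) i → lincomb (unit i) w ≈ᴹ w i
  lincomb-unit w zero    = ≈ᴹ-trans (+ᴹ-cong (*ₗ-identityˡ (w zero)) (lincomb-0 (w ∘ suc))) (+ᴹ-identityʳ _)
  lincomb-unit w (suc i) = ≈ᴹ-trans (+ᴹ-cong (*ₗ-zeroˡ (w zero)) (lincomb-unit (w ∘ suc) i)) (+ᴹ-identityˡ _)

  infix 4 _∈span_ _⊆span_

  record _∈span_ {d} (x : Carrierᴹ) (w : Family d) : Set (r ⊔ ℓm) where
    constructor combination
    field
      coeffs    : Fin d → K
      expansion : x ≈ᴹ lincomb coeffs w

  open _∈span_

  _⊆span_ : ∀ {e d} → Family e → Family d → Set (r ⊔ ℓm)
  u ⊆span w = All (_∈span w) u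

  ∈span-resp : ∀ {d} {w : Family d} {x y} → x ≈ᴹ y → x ∈span w → y ∈span w
  ∈span-resp x≈y (combination c x≈) = combination c (≈ᴹ-trans (≈ᴹ-sym x≈y) x≈)

  0∈span : ∀ {d} (w : Family d) → 0ᴹ ∈span w
  0∈span w = combination (λ _ → 0#) (≈ᴹ-sym (lincomb-0 w))

  +-∈span : ∀ {d} {w : Family d} {x y} → x ∈span w → y ∈span w → x +ᴹ y ∈span w
  +-∈span {w = w} (combination c x≈) (combination e y≈) =
    combination (λ i → c i + e i) (≈ᴹ-trans (+ᴹ-cong x≈ y≈) (≈ᴹ-sym (lincomb-+ c e w)))

  *ₗ-∈span : ∀ {d} {w : Family d} a {x} → x ∈span w → a *ₗ x ∈span w
  *ₗ-∈span {w = w} a (combination c x≈) =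
    combination (λ i → a * c i) (≈ᴹ-trans (*ₗ-congˡ x≈) (≈ᴹ-sym (lincomb-* a c w)))

  -ᴹ-∈span : ∀ {d} {w : Family d} {x} → x ∈span w → -ᴹ x ∈span w
  -ᴹ-∈span {w = w} (combination c x≈) =
    combination (λ i → - c i) (≈ᴹ-trans (-ᴹ‿cong x≈) (≈ᴹ-sym (lincomb-neg c w)))

  lincomb-∈span : ∀ {e d} {u : Family e} {w : Family d} → u ⊆span w → ∀ c → lincomb c u ∈span w
  lincomb-∈span {zero}  {w = w} u⊆w c = 0∈span w
  lincomb-∈span {suc e}         u⊆w c =
    +-∈span (*ₗ-∈span (c zero) (u⊆w zero)) (lincomb-∈span (u⊆w ∘ suc) (c ∘ suc))

  ∈span-trans : ∀ {e d} {u : Family e} {w : Family d} {x} → x ∈span u → u ⊆span w → x ∈span w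
  ∈span-trans (combination c x≈) u⊆w = ∈span-resp (≈ᴹ-sym x≈) (lincomb-∈span u⊆w c)

  ⊆span-trans : ∀ {f e d} {v : Family f} {u : Family e} {w : Family d} →
                v ⊆span u → u ⊆span w → v ⊆span w
  ⊆span-trans v⊆u u⊆w i = ∈span-trans (v⊆u i) u⊆w

  ⊆span-refl : ∀ {d} (w : Family d) → w ⊆span w
  ⊆span-refl w i = combination (unit i) (≈ᴹ-sym (lincomb-unit w i))

  tail-⊆span : ∀ {d} (w : Family (suc d)) → w ∘ suc ⊆span w
  tail-⊆span w i = ⊆span-refl w (suc i)

  ⊆span-++ˡ : ∀ {a b} (u : Family a) (v : Family b) → u ⊆span u ++ v
  ⊆span-++ˡ u v = ++⁻ˡ (_∈span u ++ v) u (⊆span-refl (u ++ v))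

  ⊆span-++ʳ : ∀ {a b} (u : Family a) (v : Family b) → v ⊆span u ++ v
  ⊆span-++ʳ u v = ++⁻ʳ (_∈span u ++ v) u (⊆span-refl (u ++ v))

  ⊆span-concat : ∀ {a b} (u : Vector (Family a) b) j → u j ⊆span concat u
  ⊆span-concat {a} u j l =
    ≡.subst (_∈span concat u) (≡.cong (uncurry (flip u) ∘ swap) (remQuot-combine j l))
            (⊆span-refl (concat u) (combine j l))

  concat⁺ : ∀ {ℓ a d} (P : Carrierᴹ → Set ℓ) (u : Vector (Family a) d) →
            (∀ j → All P (u j)) → All P (concat u)
  concat⁺ P u P-u i = P-u _ _

  ++-monoʳ-⊆span : ∀ {a d d'} (u : Family a) {v : Family d} {v' : Family d'} →
                   v ⊆span v' → u ++ v ⊆span u ++ v'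
  ++-monoʳ-⊆span u {v' = v'} v⊆v' =
    ++⁺ (_∈span u ++ v') (⊆span-++ˡ u v') (⊆span-trans v⊆v' (⊆span-++ʳ u v'))

  ∈span⇒∈ : ∀ {p d} (U : Subspace p) {w : Family d} → All (_∈_ U) w → ∀ {x} → x ∈span w → _∈_ U x
  ∈span⇒∈ U {w} w⊆U (combination c x≈) = ∈-resp U (≈ᴹ-sym x≈) (lincomb∈ w⊆U c)
    where
    lincomb∈ : ∀ {d} {w : Family d} → All (_∈_ U) w → ∀ c → _∈_ U (lincomb c w)
    lincomb∈ {zero}  w⊆U c = 0∈ U
    lincomb∈ {suc d} w⊆U c =
      +-closed U (*-closed U (c zero) (w⊆U zero)) (lincomb∈ (w⊆U ∘ suc) (c ∘ suc))

  Independent : ∀ {d} → Family d → Set (r ⊔ ℓr ⊔ ℓm)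
  Independent {d} w = ∀ (c : Fin d → K) → lincomb c w ≈ᴹ 0ᴹ → ∀ i → c i ≈ 0#

  []-independent : Independent []
  []-independent c _ ()

  independent-resp : ∀ {d} {w w' : Family d} → (∀ i → w i ≈ᴹ w' i) → Independent w → Independent w'
  independent-resp w≈w' ind c lc≈0 = ind c (≈ᴹ-trans (lincomb-cong (λ _ → ≈-refl) w≈w') lc≈0)

  _≟_ : ∀ (a b : K) → Dec (a ≈ b)
  a ≟ b with index a ≟ᶠ index b
  ... | yes e = yes (≈-trans (≈-sym (enum-index a)) (≈-trans (≈-reflexive (≡.cong enum e)) (enum-index b)))
  ... | no ne = no (ne ∘ index-cong)

  independent-∷ : ∀ {d} {w : Family d} {x} → Independent w → ¬ x ∈span w → Independent (x ∷ w)
  independent-∷ {w = w} {x} ind x∉w c lc≈0 with c zero ≟ 0#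
  ... | yes c₀≈0 = λ { zero → c₀≈0 ; (suc i) → ind (c ∘ suc) tail≈0 i }
    where
    tail≈0 : lincomb (c ∘ suc) w ≈ᴹ 0ᴹ
    tail≈0 = begin
      lincomb (c ∘ suc) w                    ≈⟨ +ᴹ-identityˡ _ ⟨
      0ᴹ +ᴹ lincomb (c ∘ suc) w              ≈⟨ +ᴹ-congʳ (≈ᴹ-trans (*ₗ-congʳ c₀≈0) (*ₗ-zeroˡ x)) ⟨
      c zero *ₗ x +ᴹ lincomb (c ∘ suc) w     ≈⟨ lc≈0 ⟩
      0ᴹ                                     ∎
  ... | no c₀≉0 =
    ⊥-elim (x∉w (∈span-resp x≈ (*ₗ-∈span y (-ᴹ-∈span (lincomb-∈span (⊆span-refl w) (c ∘ suc))))))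
    where
    y = proj₁ (inverse (c zero) c₀≉0)
    c₀y≈1 = proj₂ (inverse (c zero) c₀≉0)
    x≈ : y *ₗ -ᴹ lincomb (c ∘ suc) w ≈ᴹ x
    x≈ = begin
      y *ₗ -ᴹ lincomb (c ∘ suc) w  ≈⟨ *ₗ-congˡ (inverseˡ-unique _ _ lc≈0) ⟨
      y *ₗ (c zero *ₗ x)           ≈⟨ *ₗ-assoc y (c zero) x ⟨
      (y * c zero) *ₗ x            ≈⟨ *ₗ-congʳ (≈-trans (*-comm y (c zero)) c₀y≈1) ⟩
      1# *ₗ x                      ≈⟨ *ₗ-identityˡ x ⟩
      x                            ∎

  ∃-coefficients? : ∀ d {ℓ} (P : (Fin d → K) → Set ℓ) →
                    (∀ {c c'} → (∀ i → c i ≈ c' i) → P c → P c') →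
                    (∀ c → Dec (P c)) → Dec (Σ (Fin d → K) P)
  ∃-coefficients? zero P resp P? with P? (λ ())
  ... | yes p = yes (_ , p)
  ... | no ¬p = no λ (c , p) → ¬p (resp (λ ()) p)
  ∃-coefficients? (suc d) P resp P?
    with any? (λ a → ∃-coefficients? d (P ∘ (enum a ∷_))
                                    (λ e → resp λ { zero → ≈-refl ; (suc i) → e i }) (P? ∘ (enum a ∷_)))
  ... | yes (a , c , p) = yes (enum a ∷ c , p)
  ... | no ¬p = no λ (c , p) → ¬p (index (c zero) , c ∘ suc ,
                                   resp (λ { zero → ≈-sym (enum-index (c zero)) ; (suc i) → ≈-refl }) p)

  ∈span-dropHead : ∀ {d} {w : Family (suc d)} {c : Fin (suc d) → K} {x} →
                   c zero ≈ 0# → x ≈ᴹ lincomb c w → x ∈span (w ∘ suc)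
  ∈span-dropHead {w = w} {c} c₀≈0 x≈ =
    combination (c ∘ suc) (≈ᴹ-trans x≈ (≈ᴹ-trans (+ᴹ-congʳ head≈0) (+ᴹ-identityˡ _)))
    where
    head≈0 : c zero *ₗ w zero ≈ᴹ 0ᴹ
    head≈0 = ≈ᴹ-trans (*ₗ-congʳ c₀≈0) (*ₗ-zeroˡ (w zero))

  eliminate-head : ∀ {d} {w : Family (suc d)} {c e : Fin (suc d) → K} {x y z} →
                   x ≈ᴹ lincomb c w → y ≈ᴹ lincomb e w → e zero * z ≈ 1# →
                   x +ᴹ (- (c zero * z)) *ₗ y ∈span (w ∘ suc)
  eliminate-head {w = w} {c} {e} {x} {y} {z} x≈ y≈ ez≈1 =
    ∈span-dropHead {w = w} {c = λ l → c l + μ * e l} (pivot-cancel F ez≈1) (begin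
    x +ᴹ μ *ₗ y                               ≈⟨ +ᴹ-cong x≈ (*ₗ-congˡ y≈) ⟩
    lincomb c w +ᴹ μ *ₗ lincomb e w           ≈⟨ +ᴹ-congˡ (lincomb-* μ e w) ⟨
    lincomb c w +ᴹ lincomb (λ l → μ * e l) w  ≈⟨ lincomb-+ c (λ l → μ * e l) w ⟨
    lincomb (λ l → c l + μ * e l) w           ∎)
    where
    μ = - (c zero * z)

  independent-shear : ∀ {a} {u : Family (suc a)} → Independent u → ∀ i (μ : Fin a → K) →
                      Independent (λ j → u (punchIn i j) +ᴹ μ j *ₗ u i)
  independent-shear {u = u} ind i μ c lc≈0 j =
    ≈-trans (≈-reflexive (≡.sym (insertAt-punchIn c i v j))) (ind c' lc'≈0 (punchIn i j))
    where
    v  = ∑ (λ j → c j * μ j)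
    c' = insertAt c i v
    lc'≈0 : lincomb c' u ≈ᴹ 0ᴹ
    lc'≈0 = begin
      lincomb c' u
        ≈⟨ sumV-remove (λ l → c' l *ₗ u l) i ⟩
      c' i *ₗ u i +ᴹ lincomb (c' ∘ punchIn i) (u ∘ punchIn i)
        ≈⟨ +ᴹ-cong (*ₗ-congʳ (≈-reflexive (insertAt-lookup c i v)))
                   (lincomb-cong (≈-reflexive ∘ insertAt-punchIn c i v) (λ _ → ≈ᴹ-refl)) ⟩
      v *ₗ u i +ᴹ lincomb c (u ∘ punchIn i)
        ≈⟨ +ᴹ-comm _ _ ⟩
      lincomb c (u ∘ punchIn i) +ᴹ v *ₗ u i
        ≈⟨ +ᴹ-congˡ (sumV-scalars (λ j → c j * μ j) (u i)) ⟨
      lincomb c (u ∘ punchIn i) +ᴹ sumV (λ j → (c j * μ j) *ₗ u i)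
        ≈⟨ sumV-distrib-+ (λ j → c j *ₗ u (punchIn i j)) (λ j → (c j * μ j) *ₗ u i) ⟨
      sumV (λ j → c j *ₗ u (punchIn i j) +ᴹ (c j * μ j) *ₗ u i)
        ≈⟨ sumV-cong (λ j → ≈ᴹ-trans (+ᴹ-congˡ (*ₗ-assoc (c j) (μ j) (u i)))
                                     (≈ᴹ-sym (*ₗ-distribˡ (c j) _ _))) ⟩
      lincomb c (λ j → u (punchIn i j) +ᴹ μ j *ₗ u i)
        ≈⟨ lc≈0 ⟩
      0ᴹ ∎

  independent-≤ : ∀ {d a} {w : Family d} {u : Family a} → Independent u → u ⊆span w → a ℕ.≤ d
  independent-≤ {zero} {zero}  _ _ = z≤n
  independent-≤ {zero} {suc a} {u = u} ind u⊆w =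
    ⊥-elim (1≉0 (ind (unit zero) (≈ᴹ-trans (lincomb-unit u zero) (expansion (u⊆w zero))) zero))
  independent-≤ {suc d} {a} {w} ind u⊆w with any? (λ i → ¬? (coeffs (u⊆w i) zero ≟ 0#))
  ... | no noPivot = ℕ.m≤n⇒m≤1+n (independent-≤ ind λ i →
          ∈span-dropHead {w = w} {c = coeffs (u⊆w i)}
            (decidable-stable (_ ≟ 0#) (λ ≉0 → noPivot (i , ≉0))) (expansion (u⊆w i)))
  independent-≤ {suc d} {suc a} {w} {u} ind u⊆w | yes (i₀ , pivot≉0) =
    s≤s (independent-≤ (independent-shear {u = u} ind i₀ μ) reduced⊆tail)
    where
    c = coeffs ∘ u⊆w
    z = proj₁ (inverse (c i₀ zero) pivot≉0)
    μ : Fin a → K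
    μ j = - (c (punchIn i₀ j) zero * z)
    reduced⊆tail : (λ j → u (punchIn i₀ j) +ᴹ μ j *ₗ u i₀) ⊆span w ∘ suc
    reduced⊆tail j = eliminate-head {w = w} {c = c (punchIn i₀ j)} {e = c i₀}
                       (expansion (u⊆w (punchIn i₀ j))) (expansion (u⊆w i₀)) (proj₂ (inverse _ pivot≉0))

  infix 4 _⊆⟨_⟩

  _⊆⟨_⟩ : ∀ {p d} → (Carrierᴹ → Set p) → Family d → Set (r ⊔ m ⊔ ℓm ⊔ p)
  U ⊆⟨ w ⟩ = ∀ {x} → U x → x ∈span w

  basis-spans : ∀ {p k} {U : Carrierᴹ → Set p} (dim : HasDim U k) → U ⊆⟨ HasDim.basis dim ⟩
  basis-spans dim {x} x∈U = let (c , x≈) = HasDim.spanning dim x x∈U in combination c x≈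

  ∈⟨⟩ : ∀ {a} {A : Carrierᴹ → Set a} {x} → A x → ⟨ A ⟩ x
  ∈⟨⟩ {x = x} x∈A =
    1 , (λ _ → 1#) , (λ _ → x) , (λ _ → x∈A) , ≈ᴹ-sym (≈ᴹ-trans (+ᴹ-identityʳ _) (*ₗ-identityˡ x))

  ⟨⟩-minimal : ∀ {a d} {A : Carrierᴹ → Set a} {w : Family d} → A ⊆⟨ w ⟩ → ⟨ A ⟩ ⊆⟨ w ⟩
  ⟨⟩-minimal A⊆w (_ , c , v , v∈A , y≈) =
    ∈span-resp (≈ᴹ-sym y≈) (lincomb-∈span (λ l → A⊆w (v∈A l)) c)

  independent-≤-dim : ∀ {p k a} {U : Carrierᴹ → Set p} → HasDim U k →
                      {u : Family a} → Independent u → All U u → a ℕ.≤ k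
  independent-≤-dim dim ind u∈U = independent-≤ ind (λ i → basis-spans dim (u∈U i))

  ∷-++ : ∀ {a d} x (u : Family a) (v : Family d) i → ((x ∷ u) ++ v) i ≡ (x ∷ (u ++ v)) i
  ∷-++ {a} x u v zero = refl
  ∷-++ {a} x u v (suc i) with splitAt a i
  ... | inj₁ j = refl
  ... | inj₂ j = refl

  -- Equality is decidable for vectors given by coordinates in an independent family b,
  -- so extension arguments take place inside the span of b.
  module WithinSpan {s} {b : Family s} (ind-b : Independent b) where

    ≈ᴹ-decidable : ∀ {x y} → x ∈span b → y ∈span b → Dec (x ≈ᴹ y)
    ≈ᴹ-decidable {x} {y} (combination cx x≈) (combination cy y≈) with all? (λ i → cx i ≟ cy i)
    ... | yes cx≈cy =
      yes (≈ᴹ-trans x≈ (≈ᴹ-trans (lincomb-cong cx≈cy (λ _ → ≈ᴹ-refl)) (≈ᴹ-sym y≈)))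
    ... | no cx≉cy =
      no λ x≈y → cx≉cy λ i → x∙y⁻¹≈ε⇒x≈y _ _ (ind-b (λ i → cx i - cy i) (difference≈0 x≈y) i)
      where
      difference≈0 : x ≈ᴹ y → lincomb (λ i → cx i - cy i) b ≈ᴹ 0ᴹ
      difference≈0 x≈y = begin
        lincomb (λ i → cx i - cy i) b    ≈⟨ lincomb-sub cx cy b ⟩
        lincomb cx b +ᴹ -ᴹ lincomb cy b  ≈⟨ +ᴹ-cong x≈ (-ᴹ‿cong y≈) ⟨
        x +ᴹ -ᴹ y                        ≈⟨ +ᴹ-congʳ x≈y ⟩
        y +ᴹ -ᴹ y                        ≈⟨ -ᴹ‿inverseʳ y ⟩
        0ᴹ                               ∎

    ∈span? : ∀ {d} {w : Family d} → w ⊆span b → ∀ {x} → x ∈span b → Dec (x ∈span w)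
    ∈span? {d} {w} w⊆b {x} x∈b = map′ (uncurry combination) (λ (combination c x≈) → c , x≈) (
      ∃-coefficients? d (λ c → x ≈ᴹ lincomb c w)
        (λ c≈c' x≈ → ≈ᴹ-trans x≈ (lincomb-cong c≈c' (λ _ → ≈ᴹ-refl)))
        (λ c → ≈ᴹ-decidable x∈b (lincomb-∈span w⊆b c)))

    record Extension {a d} (c : Family a) (W : Family d) : Set (r ⊔ ℓr ⊔ m ⊔ ℓm) where
      field
        {size}      : ℕ
        new         : Family size
        independent : Independent (new ++ c)
        new⊆W       : new ⊆span W
        W⊆          : W ⊆span new ++ c

    extend : ∀ {a d} {c : Family a} (W : Family d) →
             Independent c → c ⊆span b → W ⊆span b → Extension c W
    extend {d = zero}  W ind-c c⊆b W⊆b = record { new = [] ; independent = ind-c ; new⊆W = λ () ; W⊆ = λ () }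
    extend {d = suc d} {c = c} W ind-c c⊆b W⊆b with extend (W ∘ suc) ind-c c⊆b (λ i → W⊆b (suc i))
    ... | record { new = h ; independent = ind ; new⊆W = h⊆ ; W⊆ = ⊆h++c }
        with ∈span? (++⁺ (_∈span b) (⊆span-trans h⊆ (λ i → W⊆b (suc i))) c⊆b) (W⊆b zero)
    ...   | yes w∈ = record
            { new = h ; independent = ind
            ; new⊆W = ⊆span-trans h⊆ (tail-⊆span W)
            ; W⊆ = λ { zero → w∈ ; (suc i) → ⊆h++c i } }
    ...   | no w∉ = record
            { new = W zero ∷ h
            ; independent = independent-resp (≈ᴹ-reflexive ∘ ≡.sym ∘ ∷-++ (W zero) h c)
                                             (independent-∷ ind w∉)
            ; new⊆W = λ { zero → ⊆span-refl W zero ; (suc i) → ⊆span-trans h⊆ (tail-⊆span W) i }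
            ; W⊆ = ⊆span-trans W⊆w∷h++c reassociate }
      where
      reassociate : W zero ∷ (h ++ c) ⊆span (W zero ∷ h) ++ c
      reassociate i = ∈span-resp (≈ᴹ-reflexive (∷-++ (W zero) h c i)) (⊆span-refl ((W zero ∷ h) ++ c) i)
      W⊆w∷h++c : W ⊆span W zero ∷ (h ++ c)
      W⊆w∷h++c zero    = ⊆span-refl (W zero ∷ (h ++ c)) zero
      W⊆w∷h++c (suc i) = ⊆span-trans ⊆h++c (tail-⊆span (W zero ∷ (h ++ c))) i

open import Data.Nat using (_≤_; _+_; _*_; _∸_)
open import Data.Nat.Tactic.RingSolver using (solve-∀)
open import Algebra.Properties.CommutativeSemigroup ℕ.+-commutativeSemigroup using (interchange; xy∙z≈xz∙y)

[k+k]∸[k∸t]≡k+t : ∀ {k t} → t ≤ k → (k + k) ∸ (k ∸ t) ≡ k + t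
[k+k]∸[k∸t]≡k+t {k} {t} t≤k =
  ≡.trans (ℕ.+-∸-assoc k (ℕ.m∸n≤m k t)) (≡.cong (k +_) (ℕ.m∸[m∸n]≡n t≤k))

three-subspaces-count : ∀ {k t ρ γ σ x} → t ≤ k → ρ + γ ≤ k → σ ≤ (k + k) ∸ (k ∸ t) →
                        x + (k ∸ t) ≤ k → (ρ + σ) + (x + γ) ≤ 2 * k + 2 * t
three-subspaces-count {k} {t} {ρ} {γ} {σ} {x} t≤k ρ+γ≤k σ≤ x+[k∸t]≤k = begin
  (ρ + σ) + (x + γ)  ≡⟨ shuffle ρ σ x γ ⟩
  (ρ + γ) + (σ + x)  ≤⟨ ℕ.+-mono-≤ ρ+γ≤k (ℕ.+-mono-≤ σ≤k+t x≤t) ⟩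
  k + ((k + t) + t)  ≡⟨ regroup k t ⟩
  2 * k + 2 * t      ∎
  where
  open ℕ.≤-Reasoning
  σ≤k+t : σ ≤ k + t
  σ≤k+t = ℕ.≤-trans σ≤ (ℕ.≤-reflexive ([k+k]∸[k∸t]≡k+t t≤k))
  x≤t : x ≤ t
  x≤t = ℕ.≤-trans (ℕ.m+n≤o⇒m≤o∸n x x+[k∸t]≤k) (ℕ.≤-reflexive (ℕ.m∸[m∸n]≡n t≤k))
  shuffle : ∀ a b c d → (a + b) + (c + d) ≡ (a + d) + (b + c)
  shuffle = solve-∀
  regroup : ∀ k t → k + ((k + t) + t) ≡ 2 * k + 2 * t
  regroup = solve-∀

module Counting {r ℓr m ℓm : Level} {F : CommutativeRing r ℓr} (FF : IsFiniteField F) (V : Module F m ℓm) where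

  open Module V using (Carrierᴹ)
  open VectorSpace V
  open LinearAlgebra FF V

  IsSCID-tail : ∀ {n p k t} {π : Fin (suc n) → Subspace p} → 2 ≤ n → IsSCID k t π → IsSCID k t (π ∘ suc)
  IsSCID-tail 2≤n scid = record
    { atLeastTwo = 2≤n
    ; distinct   = λ i j i≢j → distinct (suc i) (suc j) (i≢j ∘ suc-injective)
    ; dim-k      = dim-k ∘ suc
    ; dim-meet   = λ i j i≢j → dim-meet (suc i) (suc j) (i≢j ∘ suc-injective)
    }
    where open IsSCID scid

  record Cover {n p} (π : Fin n → Subspace p) (bound : ℕ) : Set (r ⊔ m ⊔ ℓm ⊔ p) where
    field
      {σ δ}   : ℕ
      S       : Family σ
      I       : Family δ
      size    : σ + δ ≤ bound
      S-spans : ∀ i → _∈_ (π i) ⊆⟨ S ⟩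
      I-spans : ∀ i j → i ≢ j → _∈_ (π i ∩ π j) ⊆⟨ I ⟩

  cover-bounds-dim : ∀ {n p B s d} {π : Fin n → Subspace p} → Cover π B →
                     HasDim (spanAll π) s → HasDim (spanInter π) d → s + d ≤ B
  cover-bounds-dim {s = s} {d} {π} cover dimS dimI = ℕ.≤-trans (ℕ.+-mono-≤ s≤σ d≤δ) size
    where
    open Cover cover
    s≤σ : s ≤ σ
    s≤σ = independent-≤ (HasDim.independent dimS) λ l →
            ⟨⟩-minimal {A = λ x → ∃ λ i → _∈_ (π i) x}
                       (λ (i , x∈) → S-spans i x∈) (HasDim.basis-in dimS l)
    d≤δ : d ≤ δ
    d≤δ = independent-≤ (HasDim.independent dimI) λ l →
            ⟨⟩-minimal {A = λ x → ∃ λ i → ∃ λ j → (i < j) × _∈_ (π i ∩ π j) x}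
                       (λ (i , j , i<j , x∈) → I-spans i j (<⇒≢ i<j) x∈) (HasDim.basis-in dimI l)

  module _ {s} {b : Family s} (ind-b : Independent b) where

    open WithinSpan ind-b

    extend-within : ∀ {p k a d} (U : Subspace p) → HasDim (_∈_ U) k → _∈_ U ⊆⟨ b ⟩ →
                    {c : Family a} {W : Family d} → Independent c → All (_∈_ U) c → All (_∈_ U) W →
                    Σ (Extension c W) λ e → Extension.size e + a ≤ k
    extend-within U dim U⊆b {c} {W} ind-c c∈U W∈U =
      e , independent-≤-dim dim (Extension.independent e) (++⁺ (_∈_ U) new∈U c∈U)
      where
      e = extend W ind-c (λ i → U⊆b (c∈U i)) (λ i → U⊆b (W∈U i))
      new∈U : All (_∈_ U) (Extension.new e)
      new∈U i = ∈span⇒∈ U W∈U (Extension.new⊆W e i)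

    record JointSpan {p} (U W : Subspace p) (bound : ℕ) : Set (r ⊔ m ⊔ ℓm ⊔ p) where
      field
        {σ}       : ℕ
        family    : Family σ
        U-spanned : _∈_ U ⊆⟨ family ⟩
        W-spanned : _∈_ W ⊆⟨ family ⟩
        size      : σ ≤ bound

    span-of-two : ∀ {p k₁ k₂ e} (U W : Subspace p) → HasDim (_∈_ U) k₁ → HasDim (_∈_ W) k₂ →
                  HasDim (_∈_ (U ∩ W)) e → _∈_ U ⊆⟨ b ⟩ → JointSpan U W ((k₁ + k₂) ∸ e)
    span-of-two {k₂ = k₂} {e} U W dimU dimW dimU∩W U⊆b = record
      { family    = h ++ basisW
      ; U-spanned = λ x∈ → ∈span-trans (basis-spans dimU x∈) (⊆span-trans W⊆ (++-monoʳ-⊆span h M⊆basisW))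
      ; W-spanned = λ x∈ → ∈span-trans (basis-spans dimW x∈) (⊆span-++ʳ h basisW)
      ; size      = ℕ.m+n≤o⇒m≤o∸n _ (ℕ.≤-trans (ℕ.≤-reflexive (xy∙z≈xz∙y _ k₂ e))
                                                (ℕ.+-monoˡ-≤ k₂ (proj₂ extension)))
      }
      where
      basisW = HasDim.basis dimW
      extension = extend-within U dimU U⊆b (HasDim.independent dimU∩W)
                    (proj₁ ∘ HasDim.basis-in dimU∩W) (HasDim.basis-in dimU)
      open Extension (proj₁ extension) using (W⊆) renaming (new to h)
      M⊆basisW : HasDim.basis dimU∩W ⊆span basisW
      M⊆basisW l = basis-spans dimW (proj₂ (HasDim.basis-in dimU∩W l))

    -- meets is a basis of Σⱼ π₀ ∩ πⱼ₊₁, completed by complement to a basis of π₀.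
    record HeadSplitting {n p} (k : ℕ) (π : Fin (suc n) → Subspace p) : Set (r ⊔ ℓr ⊔ m ⊔ ℓm ⊔ p) where
      field
        {γ ρ}         : ℕ
        meets         : Family γ
        complement    : Family ρ
        size          : ρ + γ ≤ k
        head-spanned  : _∈_ (π zero) ⊆⟨ complement ++ meets ⟩
        meet-spanned  : ∀ j → _∈_ (π zero ∩ π (suc j)) ⊆⟨ meets ⟩
        meets-in-tail : ∀ {τ} {T : Family τ} → (∀ j → _∈_ (π (suc j)) ⊆⟨ T ⟩) → meets ⊆span T

    splitHead : ∀ {n p k t} {π : Fin (suc n) → Subspace p} → IsSCID k t π →
                (∀ i → _∈_ (π i) ⊆⟨ b ⟩) → HeadSplitting k π
    splitHead {n} {k = k} {t} {π} scid π⊆b = record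
      { meets         = g
      ; complement    = Extension.new (proj₁ completion)
      ; size          = proj₂ completion
      ; head-spanned  = λ x∈ → ∈span-trans (basis-spans (dim-k zero) x∈) (Extension.W⊆ (proj₁ completion))
      ; meet-spanned  = λ j x∈ → ∈span-trans (basis-spans (meet j) x∈) (⊆span-trans (⊆span-concat M j) W⊆g)
      ; meets-in-tail = λ tail⊆T → ⊆span-trans g⊆W (concat⁺ (_∈span _) M λ j l →
                                     tail⊆T j (proj₂ (HasDim.basis-in (meet j) l)))
      }
      where
      open IsSCID scid
      meet : ∀ j → HasDim (_∈_ (π zero ∩ π (suc j))) (k ∸ t)
      meet j = dim-meet zero (suc j) λ ()
      M : Fin n → Family (k ∸ t)
      M j = HasDim.basis (meet j)
      W = concat M
      W∈head : All (_∈_ (π zero)) W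
      W∈head = concat⁺ (_∈_ (π zero)) M λ j l → proj₁ (HasDim.basis-in (meet j) l)
      basisOfW = extend W []-independent (λ ()) (λ i → π⊆b zero (W∈head i))
      g = Extension.new basisOfW ++ []   -- extending the empty family leaves the trailing []
      g⊆W : g ⊆span W
      g⊆W = ++⁺ (_∈span W) (Extension.new⊆W basisOfW) λ ()
      W⊆g : W ⊆span g
      W⊆g = Extension.W⊆ basisOfW
      completion = extend-within (π zero) (dim-k zero) (π⊆b zero) (Extension.independent basisOfW)
                     (λ i → ∈span⇒∈ (π zero) W∈head (g⊆W i)) (HasDim.basis-in (dim-k zero))

    cover-step : ∀ {n p k t B} {π : Fin (suc n) → Subspace p} → IsSCID k t π →
                 (∀ i → _∈_ (π i) ⊆⟨ b ⟩) → Cover (π ∘ suc) B → Cover π (k + B)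
    cover-step {π = π} scid π⊆b tail = record
      { S       = complement ++ S
      ; I       = meets ++ I
      ; size    = ℕ.≤-trans (ℕ.≤-reflexive (interchange ρ σ γ δ)) (ℕ.+-mono-≤ head.size size)
      ; S-spans = S-spans′
      ; I-spans = I-spans′
      }
      where
      open Cover tail
      module head = HeadSplitting (splitHead scid π⊆b)
      open head using (γ; ρ; meets; complement; meet-spanned)
      S-spans′ : ∀ i → _∈_ (π i) ⊆⟨ complement ++ S ⟩
      S-spans′ zero    x∈ = ∈span-trans (head.head-spanned x∈)
                                        (++-monoʳ-⊆span complement (head.meets-in-tail S-spans))
      S-spans′ (suc i) x∈ = ∈span-trans (S-spans i x∈) (⊆span-++ʳ complement S)
      I-spans′ : ∀ i j → i ≢ j → _∈_ (π i ∩ π j) ⊆⟨ meets ++ I ⟩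
      I-spans′ zero    zero    0≢0 = ⊥-elim (0≢0 refl)
      I-spans′ zero    (suc j) _   x∈         = ∈span-trans (meet-spanned j x∈) (⊆span-++ˡ meets I)
      I-spans′ (suc i) zero    _   (x∈ , x∈₀) =
        ∈span-trans (meet-spanned i (x∈₀ , x∈)) (⊆span-++ˡ meets I)
      I-spans′ (suc i) (suc j) i≢j x∈         =
        ∈span-trans (I-spans i j (i≢j ∘ ≡.cong suc) x∈) (⊆span-++ʳ meets I)

    cover-three : ∀ {p k t} {π : Fin 3 → Subspace p} → t ≤ k → IsSCID k t π →
                  (∀ i → _∈_ (π i) ⊆⟨ b ⟩) → Cover π (2 * k + 2 * t)
    cover-three {π = π} t≤k scid π⊆b = record
      { S       = complement ++ family
      ; I       = extra ++ meets
      ; size    = three-subspaces-count {ρ = head.ρ} {head.γ} t≤k head.size size (proj₂ extension)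
      ; S-spans = S-spans′
      ; I-spans = I-spans′
      }
      where
      open IsSCID scid
      module head = HeadSplitting (splitHead scid π⊆b)
      open head using (meets; complement; meet-spanned)
      open JointSpan (span-of-two (π 1F) (π 2F) (dim-k 1F) (dim-k 2F) (dim-meet 1F 2F λ ()) (π⊆b 1F))
      meet₀₁ = dim-meet 0F 1F λ ()
      meet₁₂ = dim-meet 1F 2F λ ()
      extension = extend-within (π 1F) (dim-k 1F) (π⊆b 1F) (HasDim.independent meet₀₁)
                    (proj₂ ∘ HasDim.basis-in meet₀₁) (proj₁ ∘ HasDim.basis-in meet₁₂)
      open Extension (proj₁ extension) using (W⊆) renaming (new to extra)
      tail-spanned : ∀ j → _∈_ (π (suc j)) ⊆⟨ family ⟩
      tail-spanned 0F = U-spanned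
      tail-spanned 1F = W-spanned
      S-spans′ : ∀ i → _∈_ (π i) ⊆⟨ complement ++ family ⟩
      S-spans′ 0F      x∈ = ∈span-trans (head.head-spanned x∈)
                                        (++-monoʳ-⊆span complement (head.meets-in-tail tail-spanned))
      S-spans′ (suc j) x∈ = ∈span-trans (tail-spanned j x∈) (⊆span-++ʳ complement family)
      meet₀₁⊆meets : HasDim.basis meet₀₁ ⊆span meets
      meet₀₁⊆meets l = meet-spanned 0F (HasDim.basis-in meet₀₁ l)
      meet₁₂-spanned : _∈_ (π 1F ∩ π 2F) ⊆⟨ extra ++ meets ⟩
      meet₁₂-spanned x∈ =
        ∈span-trans (basis-spans meet₁₂ x∈) (⊆span-trans W⊆ (++-monoʳ-⊆span extra meet₀₁⊆meets))
      I-spans′ : ∀ i j → i ≢ j → _∈_ (π i ∩ π j) ⊆⟨ extra ++ meets ⟩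
      I-spans′ 0F      0F      0≢0 = ⊥-elim (0≢0 refl)
      I-spans′ 0F      (suc j) _   x∈          = ∈span-trans (meet-spanned j x∈) (⊆span-++ʳ extra meets)
      I-spans′ (suc j) 0F      _   (x∈ , x∈₀)  =
        ∈span-trans (meet-spanned j (x∈₀ , x∈)) (⊆span-++ʳ extra meets)
      I-spans′ 1F      1F      1≢1 = ⊥-elim (1≢1 refl)
      I-spans′ 1F      2F      _   x∈          = meet₁₂-spanned x∈
      I-spans′ 2F      1F      _   (x∈₂ , x∈₁) = meet₁₂-spanned (x∈₁ , x∈₂)
      I-spans′ 2F      2F      2≢2 = ⊥-elim (2≢2 refl)

    cover : ∀ n {p k t} {π : Fin (3 + n) → Subspace p} → t ≤ k → IsSCID k t π →
            (∀ i → _∈_ (π i) ⊆⟨ b ⟩) → Cover π ((2 + n) * k + 2 * t)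
    cover zero    t≤k scid π⊆b = cover-three t≤k scid π⊆b
    cover (suc n) {k = k} {t} {π} t≤k scid π⊆b =
      ≡.subst (Cover π) (≡.sym (ℕ.+-assoc k ((2 + n) * k) (2 * t)))
        (cover-step scid π⊆b (cover n t≤k (IsSCID-tail (s≤s (s≤s z≤n)) scid) (π⊆b ∘ suc)))

theorem3 : ∀ {r ℓr m ℓm p : Level} (F : CommutativeRing r ℓr) → IsFiniteField F →
    (V : Module F m ℓm) → (k t : ℕ) → t ≤ k → (n : ℕ) → 3 ≤ n →
    (π : Fin n → VectorSpace.Subspace V p) → VectorSpace.IsSCID V k t π →
    (s d : ℕ) → VectorSpace.HasDim V (VectorSpace.spanAll V π) s →
    VectorSpace.HasDim V (VectorSpace.spanInter V π) d →
    s + d ≤ (n ∸ 1) * k + 2 * t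
theorem3 F FF V k t t≤k (suc (suc (suc n))) (s≤s (s≤s (s≤s z≤n))) π scid s d dimS dimI =
  cover-bounds-dim (cover (HasDim.independent dimS) n t≤k scid spaces⊆basis) dimS dimI
  where
  open VectorSpace V
  open LinearAlgebra FF V
  open Counting FF V
  spaces⊆basis : ∀ i → _∈_ (π i) ⊆⟨ HasDim.basis dimS ⟩
  spaces⊆basis i x∈ = basis-spans dimS (∈⟨⟩ (i , x∈))
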